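{- Let $K,A,B,C,D$ be formulas. If $\mathbf{IPL}\vdash K\land A\land(B\Rightarrow C)\Rightarrow B$, then \[\mathbf{IPL}\vdash \bigl((K\land((A\Rightarrow B)\Rightarrow C))\Rightarrow D\bigr)\Leftrightarrow(K\land C\Rightarrow D).\]
   Context: Formulas are built from propositional variables, constants $\bot,\top$ and connectives $\land,\lor,\Rightarrow$; $\Rightarrow$ is right associative, binds more weakly than $\land$, and $A\Leftrightarrow B$ abbreviates $(A\Rightarrow B)\land(B\Rightarrow A)$. $\mathbf{IPL}\vdash A$ means $A$ is provable in intuitionistic propositional logic. -}

module Defs where

open import Data.Nat using (ℕ)
open import Data.List using (List; []; _∷_)
open import Data.List.Membership.Propositional using (_∈_)

infixr 6 _∧′_
infixr 5 _∨′_
infixr 4 _⇒_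
infix 3 _⇔_

data Formula : Set where
  var  : ℕ → Formula
  ⊥′   : Formula
  ⊤′   : Formula
  _∧′_ : Formula → Formula → Formula
  _∨′_ : Formula → Formula → Formula
  _⇒_  : Formula → Formula → Formula

_⇔_ : Formula → Formula → Formula
A ⇔ B = (A ⇒ B) ∧′ (B ⇒ A)

Ctx : Set
Ctx = List Formula

infix 2 _⊢_
data _⊢_ (Γ : Ctx) : Formula → Set where
  hyp   : ∀ {A} → A ∈ Γ → Γ ⊢ A
  ⊤-I   : Γ ⊢ ⊤′
  ⊥-E   : ∀ {A} → Γ ⊢ ⊥′ → Γ ⊢ A
  ∧-I   : ∀ {A B} → Γ ⊢ A → Γ ⊢ B → Γ ⊢ A ∧′ B
  ∧-E₁  : ∀ {A B} → Γ ⊢ A ∧′ B → Γ ⊢ A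
  ∧-E₂  : ∀ {A B} → Γ ⊢ A ∧′ B → Γ ⊢ B
  ∨-I₁  : ∀ {A B} → Γ ⊢ A → Γ ⊢ A ∨′ B
  ∨-I₂  : ∀ {A B} → Γ ⊢ B → Γ ⊢ A ∨′ B
  ∨-E   : ∀ {A B C} → Γ ⊢ A ∨′ B → (A ∷ Γ) ⊢ C → (B ∷ Γ) ⊢ C → Γ ⊢ C
  ⇒-I   : ∀ {A B} → (A ∷ Γ) ⊢ B → Γ ⊢ A ⇒ B
  ⇒-E   : ∀ {A B} → Γ ⊢ A ⇒ B → Γ ⊢ A → Γ ⊢ B

IPL⊢ : Formula → Set
IPL⊢ A = [] ⊢ A

module Submission where

-- Write E for (A ⇒ B) ⇒ C.  Both sides of the equivalence are
-- implications into D, so it suffices that their antecedents K ∧ E and K ∧ C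
-- are interderivable (an implication X ⇒ D only depends on X up to ⇔).
--   * K ∧ C ⊢ K ∧ E is immediate: C yields (A ⇒ B) ⇒ C by discarding A ⇒ B.
--   * K ∧ E ⊢ K ∧ C uses the hypothesis K ∧ A ∧ (B ⇒ C) ⇒ B: under K and E,
--     assume A; then B ⇒ C holds (from B we get A ⇒ B, hence C by E), so the
--     hypothesis gives B.  Thus A ⇒ B, and E turns this into C.

open import Defs
open import Data.List using ([]; _∷_)
open import Data.List.Membership.Propositional using (_∈_)
open import Data.List.Relation.Unary.Any using (here; there)
open import Relation.Binary.PropositionalEquality using (refl)

Ren : Ctx → Ctx → Set
Ren Γ Δ = ∀ {X} → X ∈ Γ → X ∈ Δ

extend : ∀ {Γ Δ Y} → Ren Γ Δ → Ren (Y ∷ Γ) (Y ∷ Δ)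
extend r (here p)  = here p
extend r (there p) = there (r p)

rename : ∀ {Γ Δ X} → Ren Γ Δ → Γ ⊢ X → Δ ⊢ X
rename r (hyp x)     = hyp (r x)
rename r ⊤-I         = ⊤-I
rename r (⊥-E d)     = ⊥-E (rename r d)
rename r (∧-I d e)   = ∧-I (rename r d) (rename r e)
rename r (∧-E₁ d)    = ∧-E₁ (rename r d)
rename r (∧-E₂ d)    = ∧-E₂ (rename r d)
rename r (∨-I₁ d)    = ∨-I₁ (rename r d)
rename r (∨-I₂ d)    = ∨-I₂ (rename r d)
rename r (∨-E d e f) = ∨-E (rename r d) (rename (extend r) e) (rename (extend r) f)
rename r (⇒-I d)     = ⇒-I (rename (extend r) d)
rename r (⇒-E d e)   = ⇒-E (rename r d) (rename r e)

weaken : ∀ {Γ X Y} → Γ ⊢ X → (Y ∷ Γ) ⊢ X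
weaken = rename there

latest : ∀ {Γ X} → (X ∷ Γ) ⊢ X
latest = hyp (here refl)

discard : ∀ {Γ X C} → Γ ⊢ C → Γ ⊢ X ⇒ C
discard d = ⇒-I (weaken d)

precompose : ∀ {Γ X Y D} → Γ ⊢ Y ⇒ X → Γ ⊢ (X ⇒ D) ⇒ (Y ⇒ D)
precompose f = ⇒-I (⇒-I (⇒-E (weaken latest) (⇒-E (weaken (weaken f)) latest)))

antecedent-⇔ : ∀ {Γ X Y D} → Γ ⊢ X ⇒ Y → Γ ⊢ Y ⇒ X → Γ ⊢ (X ⇒ D) ⇔ (Y ⇒ D)
antecedent-⇔ X⇒Y Y⇒X = ∧-I (precompose Y⇒X) (precompose X⇒Y)

-- Under A, the premise B ⇒ C holds because
-- B gives A ⇒ B by discarding A, which (A ⇒ B) ⇒ C sends to C.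
recover-implication : ∀ {Γ} {K A B C : Formula} →
  Γ ⊢ K ∧′ A ∧′ (B ⇒ C) ⇒ B → Γ ⊢ K → Γ ⊢ (A ⇒ B) ⇒ C → Γ ⊢ A ⇒ B
recover-implication {Γ} {K} {A} {B} {C} h k e =
  ⇒-I (⇒-E (weaken h) (∧-I (weaken k) (∧-I latest B⇒C)))
  where
  B⇒C : (A ∷ Γ) ⊢ B ⇒ C
  B⇒C = ⇒-I (⇒-E (weaken (weaken e)) (discard latest))

conjunct-to-C : ∀ {Γ} {K A B C : Formula} →
  Γ ⊢ K ∧′ A ∧′ (B ⇒ C) ⇒ B → Γ ⊢ K ∧′ ((A ⇒ B) ⇒ C) ⇒ K ∧′ C
conjunct-to-C {Γ} {K} {A} {B} {C} h =
  ⇒-I (∧-I k (⇒-E e (recover-implication (weaken h) k e)))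
  where
  k : (K ∧′ ((A ⇒ B) ⇒ C) ∷ Γ) ⊢ K
  k = ∧-E₁ latest
  e : (K ∧′ ((A ⇒ B) ⇒ C) ∷ Γ) ⊢ (A ⇒ B) ⇒ C
  e = ∧-E₂ latest

conjunct-from-C : ∀ {Γ K X C} → Γ ⊢ K ∧′ C ⇒ K ∧′ (X ⇒ C)
conjunct-from-C = ⇒-I (∧-I (∧-E₁ latest) (discard (∧-E₂ latest)))

lemma5 : (K A B C D : Formula) →
    IPL⊢ (K ∧′ A ∧′ (B ⇒ C) ⇒ B) →
    IPL⊢ ((K ∧′ ((A ⇒ B) ⇒ C) ⇒ D) ⇔ (K ∧′ C ⇒ D))
lemma5 K A B C D h = antecedent-⇔ (conjunct-to-C h) conjunct-from-C
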